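{- Let $S$ be a numerical set with $S\neq\mathbb{N}$, and let $\widetilde{S}$ be its complement. Then $$\widetilde{S}=\{B(S)-s \mid s\in S,\ s\leq B(S)\}\cup\{n\in\mathbb{N}\mid n\geq B(S)\}.$$
   Context: $\mathbb{N}=\{0,1,2,\dots\}$. A numerical set is a subset $S\subseteq\mathbb{N}$ with $0\in S$ and $\mathbb{N}\setminus S$ finite. The elements of $\mathbb{N}\setminus S$ are the gaps of $S$. $F(S)$ is the largest gap (the Frobenius number). For $S\neq\mathbb{N}$, the base is $B(S)=\max\{s\in S\mid s<F(S)\}$. Young diagram of a numerical set $S$: it has one left-justified row of boxes for each gap $\ell$ of $S$. The top row corresponds to $F(S)$, and the gaps decrease going down. The row for the gap $\ell$ has length $|\{s\in S\mid s<\ell\}|$, so row lengths weakly decrease from top to bottom. This gives a bijection between numerical sets and Young diagrams, with $\mathbb{N}$ corresponding to the empty diagram. Complement of a Young diagram with row lengths $\lambda_1\ge\lambda_2\ge\dots\ge\lambda_g$ (top to bottom): it is the Young diagram with row lengths $\lambda_1-\lambda_g\ge\lambda_1-\lambda_{g-1}\ge\dots\ge\lambda_1-\lambda_1$, rows of length $0$ being discarded. Geometrically, complete the diagram to the $g\times\lambda_1$ rectangle, take the boxes not in the diagram, and rotate them by $180^\circ$. The complement $\widetilde{S}$ of a numerical set $S$ is the numerical set whose Young diagram is the complement of the Young diagram of $S$. In particular $\widetilde{\mathbb{N}}=\mathbb{N}$. -}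

module Defs where

open import Data.Nat using (ℕ; zero; suc; _+_; _∸_; _≤_; _<_; _<?_)
open import Data.Bool using (Bool; true; false; not)
open import Data.List using (List; []; _∷_; map; reverse; filter; length; downFrom; upTo)
open import Data.Product using (Σ; _×_; ∃; ∃-syntax)
open import Data.Sum using (_⊎_)
open import Relation.Binary.PropositionalEquality using (_≡_)

-- A numerical set: a subset of ℕ (given by its Boolean membership function)
-- containing 0 and with finite complement (witnessed by a bound beyond
-- which every natural number belongs to the set).
record NumericalSet : Set where
  field
    mem      : ℕ → Bool
    zero∈    : mem 0 ≡ true
    bound    : ℕ
    cofinite : ∀ n → bound ≤ n → mem n ≡ true

open NumericalSet public

_∈S_ : ℕ → NumericalSet → Set
n ∈S S = mem S n ≡ true

≢ℕ : NumericalSet → Set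
≢ℕ S = ∃[ n ] mem S n ≡ false

IsFrobenius : NumericalSet → ℕ → Set
IsFrobenius S f = (mem S f ≡ false) × (∀ n → f < n → mem S n ≡ true)

IsBase : NumericalSet → ℕ → Set
IsBase S b = Σ ℕ λ f → IsFrobenius S f × (b < f) × (mem S b ≡ true)
                      × (∀ s → b < s → s < f → mem S s ≡ false)

countBelow : (ℕ → Bool) → ℕ → ℕ
countBelow p zero = 0
countBelow p (suc ℓ) with p ℓ
... | true  = suc (countBelow p ℓ)
... | false = countBelow p ℓ

-- gaps of S, in decreasing order (all gaps are < bound S)
gaps : NumericalSet → List ℕ
gaps S = filter (λ n → not (mem S n) Data.Bool.≟ true) (downFrom (bound S))

-- Young diagram of S: row lengths, top row (for F(S)) first
youngDiagram : NumericalSet → List ℕ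
youngDiagram S = map (countBelow (mem S)) (gaps S)

complementDiagram : List ℕ → List ℕ
complementDiagram []          = []
complementDiagram (l₁ ∷ rows) =
  filter (λ x → 0 <? x) (map (λ l → l₁ ∸ l) (reverse (l₁ ∷ rows)))

InRHS : NumericalSet → ℕ → ℕ → Set
InRHS S b n = (∃[ s ] (s ∈S S) × (s ≤ b) × (n ≡ b ∸ s)) ⊎ (b ≤ n)

-- Write p for the membership function of S, b = B(S), f = F(S) and m = |S ∩ [0, b]|.
-- Every integer in (b, f] is a gap of S, and each of these f − b gaps has row length m, so
-- the diagram of S is f − b rows of length m on top of the rows of the gaps ℓ < b, all
-- shorter than m. Its complement therefore has one row of length m − |S ∩ [0, ℓ)| for each
-- gap ℓ < b, taken in increasing order. The set T = {b − s | s ∈ S, s ≤ b} ∪ [b, ∞) has gaps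
-- b − ℓ for exactly these ℓ (as 0, b ∈ S), and the row of b − ℓ counts the elements of T
-- below b − ℓ, i.e. the elements of S in (ℓ, b]: again m − |S ∩ [0, ℓ)|. Finally a Young
-- diagram determines its numerical set, since the gap of a row is its length plus the
-- number of rows below it.
module Submission where

open import Defs
open import Data.Bool as Bool using (Bool; true; false; not; if_then_else_)
open import Data.Nat using (ℕ; zero; suc; _+_; _∸_; _≤_; _<_; _<?_; _≤?_; z≤n)
open import Data.Nat.Properties
  using (≤-refl; ≤-trans; ≤-<-trans; <⇒≤; <⇒≱; ≰⇒>; n≤1+n; m≤n+m; m≤n⇒m<n∨m≡n; m<1+n⇒m≤n; n≮0;
         +-identityʳ; +-suc; m+n∸n≡m; m∸n≤m; m∸n+n≡m; m∸[m∸n]≡n; n∸n≡0; +-∸-assoc; m<n⇒0<n∸m;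
         m≤o∸n⇒m+n≤o)
open import Data.List using (List; []; _∷_; _++_; map; reverse; filter; length; downFrom; replicate)
open import Data.List.Properties
  using (map-++; map-∘; map-cong-local; length-map; ++-identityʳ; ++-assoc; reverse-++; reverse-map;
         filter-++; filter-all; filter-none)
open import Data.List.Relation.Unary.All as All using (All)
open import Data.List.Relation.Unary.All.Properties using (map⁺; replicate⁺)
open import Data.List.Relation.Unary.Any using (here)
open import Data.List.Relation.Unary.Any.Properties using (reverse⁻)
open import Data.List.Membership.Propositional using (_∈_)
open import Data.List.Membership.Propositional.Properties using (∈-++⁺ˡ; ∈-++⁺ʳ; ∈-++⁻)
open import Data.Product using (_×_; ∃-syntax; _,_; proj₁; proj₂)
open import Data.Sum using (inj₁; inj₂)
open import Function using (_∘_)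
open import Function.Bundles using (_⇔_; mk⇔; Equivalence)
open import Relation.Nullary using (yes; no; ¬_; contradiction)
open import Relation.Binary.PropositionalEquality
  using (_≡_; refl; sym; trans; cong; cong₂; subst; module ≡-Reasoning)

open ≡-Reasoning

All-reverse⁺ : ∀ {A : Set} {P : A → Set} {xs : List A} → All P xs → All P (reverse xs)
All-reverse⁺ all = All.tabulate (All.lookup all ∘ reverse⁻)

gapAt : (ℕ → Bool) → ℕ → List ℕ
gapAt p x = if p x then [] else x ∷ []

gapsBelow : (ℕ → Bool) → ℕ → List ℕ
gapsBelow p zero    = []
gapsBelow p (suc n) = gapAt p n ++ gapsBelow p n

gapsFrom : (ℕ → Bool) → ℕ → ℕ → List ℕ
gapsFrom p lo zero    = []
gapsFrom p lo (suc k) = gapAt p lo ++ gapsFrom p (suc lo) k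

gapAt-∈ : ∀ p {x} → p x ≡ true → gapAt p x ≡ []
gapAt-∈ p e rewrite e = refl

gapAt-∉ : ∀ p {x} → p x ≡ false → gapAt p x ≡ x ∷ []
gapAt-∉ p e rewrite e = refl

gapAt-transfer : ∀ (p q : ℕ → Bool) {f : ℕ → ℕ} {x y} → q y ≡ p x → f x ≡ y →
                 gapAt q y ≡ map f (gapAt p x)
gapAt-transfer p q {x = x} {y} e refl with q y | p x
... | true  | true  = refl
... | false | false = refl
... | true  | false = contradiction e λ ()
... | false | true  = contradiction e λ ()

reverse-gapAt : ∀ p x → reverse (gapAt p x) ≡ gapAt p x
reverse-gapAt p x with p x
... | true  = refl
... | false = refl

∈-gapAt⁻ : ∀ {p x ℓ} → ℓ ∈ gapAt p x → ℓ ≡ x × p x ≡ false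
∈-gapAt⁻ {p} {x} ℓ∈ with p x
∈-gapAt⁻ (here ℓ≡x) | false = ℓ≡x , refl

gapsFrom-snoc : ∀ p lo k → gapsFrom p lo (suc k) ≡ gapsFrom p lo k ++ gapAt p (lo + k)
gapsFrom-snoc p lo zero rewrite +-identityʳ lo = ++-identityʳ (gapAt p lo)
gapsFrom-snoc p lo (suc k) = begin
  gapAt p lo ++ gapsFrom p (suc lo) (suc k)            ≡⟨ cong (gapAt p lo ++_) (gapsFrom-snoc p (suc lo) k) ⟩
  gapAt p lo ++ (gapsFrom p (suc lo) k ++ gapAt p (suc lo + k))
    ≡⟨ sym (++-assoc (gapAt p lo) _ _) ⟩
  gapsFrom p lo (suc k) ++ gapAt p (suc lo + k)
    ≡⟨ cong (λ x → gapsFrom p lo (suc k) ++ gapAt p x) (sym (+-suc lo k)) ⟩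
  gapsFrom p lo (suc k) ++ gapAt p (lo + suc k)        ∎

reverse-gapsBelow : ∀ p n → reverse (gapsBelow p n) ≡ gapsFrom p 0 n
reverse-gapsBelow p zero    = refl
reverse-gapsBelow p (suc n) = begin
  reverse (gapAt p n ++ gapsBelow p n)           ≡⟨ reverse-++ (gapAt p n) (gapsBelow p n) ⟩
  reverse (gapsBelow p n) ++ reverse (gapAt p n) ≡⟨ cong₂ _++_ (reverse-gapsBelow p n) (reverse-gapAt p n) ⟩
  gapsFrom p 0 n ++ gapAt p n                    ≡⟨ sym (gapsFrom-snoc p 0 n) ⟩
  gapsFrom p 0 (suc n)                           ∎

gapsFrom-1≡gapsFrom-0 : ∀ {p} n → p 0 ≡ true → p n ≡ true → gapsFrom p 1 n ≡ gapsFrom p 0 n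
gapsFrom-1≡gapsFrom-0 zero    _  _  = refl
gapsFrom-1≡gapsFrom-0 {p} (suc n) p0 pn = begin
  gapsFrom p 1 (suc n)              ≡⟨ gapsFrom-snoc p 1 n ⟩
  gapsFrom p 1 n ++ gapAt p (suc n) ≡⟨ cong (gapsFrom p 1 n ++_) (gapAt-∈ p pn) ⟩
  gapsFrom p 1 n ++ []              ≡⟨ ++-identityʳ _ ⟩
  gapsFrom p 1 n                    ≡⟨ cong (_++ gapsFrom p 1 n) (sym (gapAt-∈ p p0)) ⟩
  gapsFrom p 0 (suc n)              ∎

∈-gapsBelow⁻ : ∀ {p ℓ} n → ℓ ∈ gapsBelow p n → p ℓ ≡ false × ℓ < n
∈-gapsBelow⁻ {p} (suc n) ℓ∈ with ∈-++⁻ (gapAt p n) ℓ∈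
... | inj₁ ℓ∈gap with refl , e ← ∈-gapAt⁻ {p} ℓ∈gap = e , ≤-refl
... | inj₂ ℓ∈gaps with e , ℓ<n ← ∈-gapsBelow⁻ n ℓ∈gaps = e , ≤-trans ℓ<n (n≤1+n n)

∈-gapsBelow⁺ : ∀ {p ℓ} n → p ℓ ≡ false → ℓ < n → ℓ ∈ gapsBelow p n
∈-gapsBelow⁺ {p} {ℓ} (suc n) e ℓ<1+n with m≤n⇒m<n∨m≡n (m<1+n⇒m≤n ℓ<1+n)
... | inj₁ ℓ<n  = ∈-++⁺ʳ (gapAt p n) (∈-gapsBelow⁺ n e ℓ<n)
... | inj₂ refl = ∈-++⁺ˡ (subst (ℓ ∈_) (sym (gapAt-∉ p e)) (here refl))

gapsBelow-stable : ∀ {p m} → (∀ n → m ≤ n → p n ≡ true) →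
                   ∀ k → gapsBelow p (k + m) ≡ gapsBelow p m
gapsBelow-stable in-p zero    = refl
gapsBelow-stable {p} {m} in-p (suc k) =
  cong₂ _++_ (gapAt-∈ p (in-p (k + m) (m≤n+m m k))) (gapsBelow-stable in-p k)

gaps≡gapsBelow : ∀ S → gaps S ≡ gapsBelow (mem S) (bound S)
gaps≡gapsBelow S = filter-downFrom (bound S)
  where
  p = mem S
  filter-downFrom : ∀ n → filter (λ m → not (p m) Bool.≟ true) (downFrom n) ≡ gapsBelow p n
  filter-downFrom zero = refl
  filter-downFrom (suc n) with p n
  ... | true  = filter-downFrom n
  ... | false = cong (n ∷_) (filter-downFrom n)

gap<bound : ∀ S {n} → mem S n ≡ false → n < bound S
gap<bound S {n} e with suc n ≤? bound S
... | yes n<bound = n<bound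
... | no  n≮bound = contradiction (trans (sym (cofinite S n (m<1+n⇒m≤n (≰⇒> n≮bound)))) e) λ ()

countBelow-gap : ∀ p {n} → p n ≡ false → countBelow p (suc n) ≡ countBelow p n
countBelow-gap p {n} e rewrite e = refl

countBelow-∈ : ∀ p {n} → p n ≡ true → countBelow p n < countBelow p (suc n)
countBelow-∈ p {n} e rewrite e = ≤-refl

countBelow-≤-suc : ∀ p n → countBelow p n ≤ countBelow p (suc n)
countBelow-≤-suc p n with p n
... | true  = n≤1+n _
... | false = ≤-refl

countBelow-mono : ∀ p {m} n → m ≤ n → countBelow p m ≤ countBelow p n
countBelow-mono p zero    z≤n = ≤-refl
countBelow-mono p (suc n) m≤1+n with m≤n⇒m<n∨m≡n m≤1+n
... | inj₁ m<1+n = ≤-trans (countBelow-mono p n (m<1+n⇒m≤n m<1+n)) (countBelow-≤-suc p n)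
... | inj₂ refl  = ≤-refl

countBelow-+-length-gapsBelow : ∀ p n → countBelow p n + length (gapsBelow p n) ≡ n
countBelow-+-length-gapsBelow p zero = refl
countBelow-+-length-gapsBelow p (suc n) with p n
... | true  = cong suc (countBelow-+-length-gapsBelow p n)
... | false = trans (+-suc _ _) (cong suc (countBelow-+-length-gapsBelow p n))

decode : List ℕ → List ℕ
decode []         = []
decode (l ∷ rows) = l + length rows ∷ decode rows

decode-rows : ∀ p n → decode (map (countBelow p) (gapsBelow p n)) ≡ gapsBelow p n
decode-rows p zero = refl
decode-rows p (suc n) with p n
... | true  = decode-rows p n
... | false = cong₂ _∷_ row (decode-rows p n)
  where
  row : countBelow p n + length (map (countBelow p) (gapsBelow p n)) ≡ n
  row = trans (cong (countBelow p n +_) (length-map (countBelow p) (gapsBelow p n)))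
              (countBelow-+-length-gapsBelow p n)

gapsBelow≡decode : ∀ S → gapsBelow (mem S) (bound S) ≡ decode (youngDiagram S)
gapsBelow≡decode S = trans (sym (decode-rows (mem S) (bound S)))
                           (cong (decode ∘ map (countBelow (mem S))) (sym (gaps≡gapsBelow S)))

gap⇔∈decode : ∀ S {n} → mem S n ≡ false ⇔ n ∈ decode (youngDiagram S)
gap⇔∈decode S = mk⇔
  (λ e → subst (_ ∈_) (gapsBelow≡decode S) (∈-gapsBelow⁺ (bound S) e (gap<bound S e)))
  (λ n∈ → proj₁ (∈-gapsBelow⁻ (bound S) (subst (_ ∈_) (sym (gapsBelow≡decode S)) n∈)))

youngDiagram-gap : ∀ S T {n} → youngDiagram S ≡ youngDiagram T → mem S n ≡ false → mem T n ≡ false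
youngDiagram-gap S T eq e =
  Equivalence.from (gap⇔∈decode T) (subst (_ ∈_) (cong decode eq) (Equivalence.to (gap⇔∈decode S) e))

youngDiagram-injective : ∀ S T → youngDiagram S ≡ youngDiagram T → ∀ n → mem S n ≡ mem T n
youngDiagram-injective S T eq n with mem S n in eS | mem T n in eT
... | true  | true  = refl
... | false | false = refl
... | true  | false = contradiction (trans (sym eS) (youngDiagram-gap T S (sym eq) eT)) λ ()
... | false | true  = contradiction (trans (sym eT) (youngDiagram-gap S T eq eS)) λ ()

countBelow-transfer : ∀ (p q : ℕ → Bool) {m n} → q m ≡ p n →
                      countBelow q (suc m) + countBelow p n ≡ countBelow q m + countBelow p (suc n)
countBelow-transfer p q {m} {n} e with q m | p n
... | true  | true  = sym (+-suc _ _)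
... | false | false = refl
... | true  | false = contradiction e λ ()
... | false | true  = contradiction e λ ()

-- n ↦ c ∸ n maps [0, k) onto (c ∸ k, c].
module Mirror {p q : ℕ → Bool} {c : ℕ} (mirror : ∀ n → n < c → q n ≡ p (c ∸ n)) where

  countBelow-mirror : ∀ k → k ≤ c → countBelow q k + countBelow p (suc (c ∸ k)) ≡ countBelow p (suc c)
  countBelow-mirror zero    _   = refl
  countBelow-mirror (suc k) k<c = begin
    countBelow q (suc k) + countBelow p (suc (c ∸ suc k))
      ≡⟨ cong (λ x → countBelow q (suc k) + countBelow p x) (sym (+-∸-assoc 1 k<c)) ⟩
    countBelow q (suc k) + countBelow p (c ∸ k) ≡⟨ countBelow-transfer p q (mirror k k<c) ⟩
    countBelow q k + countBelow p (suc (c ∸ k)) ≡⟨ countBelow-mirror k (<⇒≤ k<c) ⟩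
    countBelow p (suc c)                        ∎

  gapsBelow-mirror : ∀ k → k ≤ c → gapsBelow q k ≡ map (c ∸_) (gapsFrom p (suc (c ∸ k)) k)
  gapsBelow-mirror zero    _   = refl
  gapsBelow-mirror (suc k) k<c = begin
    gapAt q k ++ gapsBelow q k
      ≡⟨ cong₂ _++_ (gapAt-transfer p q (mirror k k<c) (m∸[m∸n]≡n (<⇒≤ k<c)))
                    (gapsBelow-mirror k (<⇒≤ k<c)) ⟩
    map (c ∸_) (gapAt p (c ∸ k)) ++ map (c ∸_) (gapsFrom p (suc (c ∸ k)) k)
      ≡⟨ sym (map-++ (c ∸_) (gapAt p (c ∸ k)) _) ⟩
    map (c ∸_) (gapsFrom p (c ∸ k) (suc k))
      ≡⟨ cong (λ x → map (c ∸_) (gapsFrom p x (suc k))) (+-∸-assoc 1 k<c) ⟩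
    map (c ∸_) (gapsFrom p (suc (c ∸ suc k)) (suc k)) ∎

countBelow-gapRun : ∀ p n j → (∀ i → i < j → p (i + n) ≡ false) → countBelow p (j + n) ≡ countBelow p n
countBelow-gapRun p n zero    _   = refl
countBelow-gapRun p n (suc j) run =
  trans (countBelow-gap p (run j ≤-refl)) (countBelow-gapRun p n j (λ i i<j → run i (≤-trans i<j (n≤1+n j))))

rows-gapRun : ∀ p n j → (∀ i → i < j → p (i + n) ≡ false) →
              map (countBelow p) (gapsBelow p (j + n))
                ≡ replicate j (countBelow p n) ++ map (countBelow p) (gapsBelow p n)
rows-gapRun p n zero    _   = refl
rows-gapRun p n (suc j) run = begin
  map (countBelow p) (gapAt p (j + n) ++ gapsBelow p (j + n))
    ≡⟨ cong (λ g → map (countBelow p) (g ++ gapsBelow p (j + n))) (gapAt-∉ p (run j ≤-refl)) ⟩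
  countBelow p (j + n) ∷ map (countBelow p) (gapsBelow p (j + n))
    ≡⟨ cong₂ _∷_ (countBelow-gapRun p n j run′) (rows-gapRun p n j run′) ⟩
  countBelow p n ∷ replicate j (countBelow p n) ++ map (countBelow p) (gapsBelow p n) ∎
  where
  run′ : ∀ i → i < j → p (i + n) ≡ false
  run′ i i<j = run i (≤-trans i<j (n≤1+n j))

complementDiagram-flatTop : ∀ {m} k rows → 0 < k → All (_< m) rows →
                            complementDiagram (replicate k m ++ rows) ≡ map (m ∸_) (reverse rows)
complementDiagram-flatTop {m} k@(suc _) rows _ rows<m = begin
  filter positive? (map (m ∸_) (reverse (replicate k m ++ rows)))
    ≡⟨ cong (filter positive? ∘ map (m ∸_)) (reverse-++ (replicate k m) rows) ⟩
  filter positive? (map (m ∸_) (reverse rows ++ reverse (replicate k m)))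
    ≡⟨ cong (filter positive?) (map-++ (m ∸_) (reverse rows) _) ⟩
  filter positive? (map (m ∸_) (reverse rows) ++ map (m ∸_) (reverse (replicate k m)))
    ≡⟨ filter-++ positive? (map (m ∸_) (reverse rows)) _ ⟩
  filter positive? (map (m ∸_) (reverse rows)) ++ filter positive? (map (m ∸_) (reverse (replicate k m)))
    ≡⟨ cong₂ _++_ (filter-all positive? shortRows) (filter-none positive? fullRows) ⟩
  map (m ∸_) (reverse rows) ++ [] ≡⟨ ++-identityʳ _ ⟩
  map (m ∸_) (reverse rows)       ∎
  where
  positive? = λ (x : ℕ) → 0 <? x
  shortRows : All (0 <_) (map (m ∸_) (reverse rows))
  shortRows = map⁺ (All.map m<n⇒0<n∸m (All-reverse⁺ rows<m))
  fullRows : All (λ x → ¬ 0 < x) (map (m ∸_) (reverse (replicate k m)))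
  fullRows = map⁺ (All.map (λ { refl 0<m∸m → n≮0 (subst (0 <_) (n∸n≡0 m) 0<m∸m) })
                            (All-reverse⁺ (replicate⁺ {P = _≡ m} k refl)))

youngDiagram-aboveBase : ∀ S {b f} → IsFrobenius S f → b < f → b ∈S S →
                         (∀ s → b < s → s < f → mem S s ≡ false) →
                         youngDiagram S ≡ replicate (f ∸ b) (countBelow (mem S) (suc b))
                                            ++ map (countBelow (mem S)) (gapsBelow (mem S) b)
youngDiagram-aboveBase S {b} {f} (f∉S , above-f) b<f b∈S between = begin
  map (countBelow p) (gaps S)                             ≡⟨ cong (map (countBelow p)) gaps≡gapsBelow-f ⟩
  map (countBelow p) (gapsBelow p ((f ∸ b) + suc b))      ≡⟨ rows-gapRun p (suc b) (f ∸ b) gapRun ⟩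
  replicate (f ∸ b) (countBelow p (suc b)) ++ map (countBelow p) (gapAt p b ++ gapsBelow p b)
    ≡⟨ cong (λ g → replicate (f ∸ b) (countBelow p (suc b)) ++ map (countBelow p) (g ++ gapsBelow p b))
            (gapAt-∈ p b∈S) ⟩
  replicate (f ∸ b) (countBelow p (suc b)) ++ map (countBelow p) (gapsBelow p b) ∎
  where
  p = mem S
  gaps≡gapsBelow-f : gaps S ≡ gapsBelow p ((f ∸ b) + suc b)
  gaps≡gapsBelow-f = begin
    gaps S                                 ≡⟨ gaps≡gapsBelow S ⟩
    gapsBelow p (bound S)                  ≡⟨ cong (gapsBelow p) (sym (m∸n+n≡m (gap<bound S f∉S))) ⟩
    gapsBelow p (bound S ∸ suc f + suc f)  ≡⟨ gapsBelow-stable above-f (bound S ∸ suc f) ⟩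
    gapsBelow p (suc f)
      ≡⟨ cong (gapsBelow p) (sym (trans (+-suc (f ∸ b) b) (cong suc (m∸n+n≡m (<⇒≤ b<f))))) ⟩
    gapsBelow p ((f ∸ b) + suc b)          ∎
  gapRun : ∀ i → i < f ∸ b → p (i + suc b) ≡ false
  gapRun i i<f∸b
    with m≤n⇒m<n∨m≡n (subst (_≤ f) (sym (+-suc i b)) (m≤o∸n⇒m+n≤o (suc i) (<⇒≤ b<f) i<f∸b))
  ... | inj₁ <f = between (i + suc b) (m≤n+m (suc b) i) <f
  ... | inj₂ ≡f = subst (λ s → p s ≡ false) (sym ≡f) f∉S

complementDiagram-youngDiagram : ∀ S {b} → IsBase S b →
  complementDiagram (youngDiagram S)
    ≡ map (λ ℓ → countBelow (mem S) (suc b) ∸ countBelow (mem S) ℓ) (reverse (gapsBelow (mem S) b))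
complementDiagram-youngDiagram S {b} (f , frob , b<f , b∈S , between) = begin
  complementDiagram (youngDiagram S)
    ≡⟨ cong complementDiagram (youngDiagram-aboveBase S frob b<f b∈S between) ⟩
  complementDiagram (replicate (f ∸ b) m ++ map (countBelow p) (gapsBelow p b))
    ≡⟨ complementDiagram-flatTop (f ∸ b) _ (m<n⇒0<n∸m b<f) rows<m ⟩
  map (m ∸_) (reverse (map (countBelow p) (gapsBelow p b)))
    ≡⟨ cong (map (m ∸_)) (sym (reverse-map (countBelow p) (gapsBelow p b))) ⟩
  map (m ∸_) (map (countBelow p) (reverse (gapsBelow p b)))
    ≡⟨ sym (map-∘ (reverse (gapsBelow p b))) ⟩
  map (λ ℓ → m ∸ countBelow p ℓ) (reverse (gapsBelow p b)) ∎
  where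
  p = mem S
  m = countBelow p (suc b)
  rows<m : All (_< m) (map (countBelow p) (gapsBelow p b))
  rows<m = map⁺ (All.tabulate λ ℓ∈ →
    ≤-<-trans (countBelow-mono p b (<⇒≤ (proj₂ (∈-gapsBelow⁻ b ℓ∈)))) (countBelow-∈ p b∈S))

reflectAt : ℕ → (ℕ → Bool) → ℕ → Bool
reflectAt b p n with b ≤? n
... | yes _ = true
... | no  _ = p (b ∸ n)

reflectAt-< : ∀ b p n → n < b → reflectAt b p n ≡ p (b ∸ n)
reflectAt-< b p n n<b with b ≤? n
... | yes b≤n = contradiction b≤n (<⇒≱ n<b)
... | no  _   = refl

reflectAt-≥ : ∀ b p n → b ≤ n → reflectAt b p n ≡ true
reflectAt-≥ b p n b≤n with b ≤? n
... | yes _   = refl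
... | no  b≰n = contradiction b≤n b≰n

reflection : (S : NumericalSet) (b : ℕ) → b ∈S S → NumericalSet
reflection S b b∈S = record
  { mem      = reflectAt b (mem S)
  ; zero∈    = zero∈′
  ; bound    = b
  ; cofinite = reflectAt-≥ b (mem S)
  }
  where
  zero∈′ : reflectAt b (mem S) 0 ≡ true
  zero∈′ with b ≤? 0
  ... | yes _ = refl
  ... | no  _ = b∈S

∈reflection⇔ : ∀ S b (b∈S : b ∈S S) n → (n ∈S reflection S b b∈S) ⇔ InRHS S b n
∈reflection⇔ S b b∈S n = mk⇔ to from
  where
  to : reflectAt b (mem S) n ≡ true → InRHS S b n
  to e with b ≤? n
  ... | yes b≤n = inj₂ b≤n
  ... | no  b≰n = inj₁ (b ∸ n , e , m∸n≤m b n , sym (m∸[m∸n]≡n (<⇒≤ (≰⇒> b≰n))))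
  from : InRHS S b n → reflectAt b (mem S) n ≡ true
  from (inj₂ b≤n)                = reflectAt-≥ b (mem S) n b≤n
  from (inj₁ (s , s∈S , s≤b , refl)) with b ≤? b ∸ s
  ... | yes _ = refl
  ... | no  _ = subst (λ x → mem S x ≡ true) (sym (m∸[m∸n]≡n s≤b)) s∈S

youngDiagram-reflection : ∀ S b (b∈S : b ∈S S) →
  youngDiagram (reflection S b b∈S)
    ≡ map (λ ℓ → countBelow (mem S) (suc b) ∸ countBelow (mem S) ℓ) (reverse (gapsBelow (mem S) b))
youngDiagram-reflection S b b∈S = begin
  map (countBelow q) (gaps (reflection S b b∈S))
    ≡⟨ cong (map (countBelow q)) (gaps≡gapsBelow (reflection S b b∈S)) ⟩
  map (countBelow q) (gapsBelow q b)
    ≡⟨ cong (map (countBelow q)) (gapsBelow-mirror b ≤-refl) ⟩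
  map (countBelow q) (map (b ∸_) (gapsFrom p (suc (b ∸ b)) b))
    ≡⟨ cong (λ x → map (countBelow q) (map (b ∸_) (gapsFrom p (suc x) b))) (n∸n≡0 b) ⟩
  map (countBelow q) (map (b ∸_) (gapsFrom p 1 b))
    ≡⟨ cong (map (countBelow q) ∘ map (b ∸_))
            (trans (gapsFrom-1≡gapsFrom-0 b (zero∈ S) b∈S) (sym (reverse-gapsBelow p b))) ⟩
  map (countBelow q) (map (b ∸_) (reverse (gapsBelow p b))) ≡⟨ sym (map-∘ (reverse (gapsBelow p b))) ⟩
  map (countBelow q ∘ (b ∸_)) (reverse (gapsBelow p b))
    ≡⟨ map-cong-local (All-reverse⁺ (All.tabulate (λ ℓ∈ → row (∈-gapsBelow⁻ b ℓ∈)))) ⟩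
  map (λ ℓ → m ∸ countBelow p ℓ) (reverse (gapsBelow p b)) ∎
  where
  p = mem S
  q = reflectAt b p
  m = countBelow p (suc b)
  open Mirror {p} {q} {b} (reflectAt-< b p)
  row : ∀ {ℓ} → p ℓ ≡ false × ℓ < b → countBelow q (b ∸ ℓ) ≡ m ∸ countBelow p ℓ
  row {ℓ} (ℓ∉S , ℓ<b) = begin
    countBelow q (b ∸ ℓ)                                  ≡⟨ sym (m+n∸n≡m _ (countBelow p ℓ)) ⟩
    countBelow q (b ∸ ℓ) + countBelow p ℓ ∸ countBelow p ℓ
      ≡⟨ cong (λ x → countBelow q (b ∸ ℓ) + countBelow p x ∸ countBelow p ℓ)
              (sym (m∸[m∸n]≡n (<⇒≤ ℓ<b))) ⟩
    countBelow q (b ∸ ℓ) + countBelow p (b ∸ (b ∸ ℓ)) ∸ countBelow p ℓ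
      ≡⟨ cong (λ x → countBelow q (b ∸ ℓ) + x ∸ countBelow p ℓ) (sym (countBelow-gap p ℓ∉S′)) ⟩
    countBelow q (b ∸ ℓ) + countBelow p (suc (b ∸ (b ∸ ℓ))) ∸ countBelow p ℓ
      ≡⟨ cong (_∸ countBelow p ℓ) (countBelow-mirror (b ∸ ℓ) (m∸n≤m b ℓ)) ⟩
    m ∸ countBelow p ℓ                                    ∎
    where
    ℓ∉S′ : p (b ∸ (b ∸ ℓ)) ≡ false
    ℓ∉S′ = subst (λ x → p x ≡ false) (sym (m∸[m∸n]≡n (<⇒≤ ℓ<b))) ℓ∉S

theorem2p2 : (S : NumericalSet) → ≢ℕ S → (b : ℕ) → IsBase S b →
    (∃[ T ] youngDiagram T ≡ complementDiagram (youngDiagram S))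
    × ((T : NumericalSet) → youngDiagram T ≡ complementDiagram (youngDiagram S) →
       (n : ℕ) → (n ∈S T) ⇔ InRHS S b n)
theorem2p2 S _ b base@(_ , _ , _ , b∈S , _) = (T , T-complement) , characterisation
  where
  T = reflection S b b∈S
  T-complement : youngDiagram T ≡ complementDiagram (youngDiagram S)
  T-complement = trans (youngDiagram-reflection S b b∈S) (sym (complementDiagram-youngDiagram S base))
  characterisation : (T′ : NumericalSet) → youngDiagram T′ ≡ complementDiagram (youngDiagram S) →
                     (n : ℕ) → (n ∈S T′) ⇔ InRHS S b n
  characterisation T′ eq n =
    subst (λ x → (x ≡ true) ⇔ InRHS S b n)
          (youngDiagram-injective T T′ (trans T-complement (sym eq)) n)
          (∈reflection⇔ S b b∈S n)
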